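{- The halved Farey graph $\check{F}$ and the Farey graph $F$ are minor-equivalent, i.e. each is a minor of the other.
   Context: Graphs are simple and may be infinite. $H$ is a minor of $G$ if there are disjoint non-empty vertex sets $V_h\subseteq V(G)$ ($h\in V(H)$), each inducing a connected subgraph, with a $V_h$–$V_{h'}$ edge in $G$ whenever $hh'\in E(H)$. The halved Farey graph of order $0$, $\check F_0$, is a $K^2$ whose single edge is coloured blue. Inductively, $\check F_{n+1}$ is obtained from $\check F_n$ by adding, for every blue edge $e$ of $\check F_n$, a new vertex $v_e$ joined exactly to the two endvertices of $e$ by two blue edges, and recolouring all edges of $\check F_n$ black. The halved Farey graph is $\check F=\bigcup_{n\in\mathbb N}\check F_n$ (ignoring colours). The Farey graph $F$ is the union $G_1\cup G_2$ of two copies $G_1,G_2$ of $\check F$ with $G_1\cap G_2=\check F_0$ (equivalently, the graph on $\mathbb{Q}\cup\{\infty\}$ in which $a/b$ and $c/d$ in lowest terms, with $\infty=(\pm1)/0$, are adjacent iff $ad-bc=\pm1$). -}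

module Defs where

open import Data.Bool using (Bool; true; false)
open import Data.List using (List; []; _∷_)
open import Data.Product using (Σ; ∃; _×_; _,_; proj₁; proj₂)
open import Data.Sum using (_⊎_)
open import Relation.Binary.PropositionalEquality using (_≡_; _≢_)
open import Relation.Nullary using (¬_)

record Graph : Set₁ where
  field
    V   : Set
    Adj : V → V → Set
open Graph public

data WalkIn (G : Graph) (P : V G → Set) : V G → V G → Set where
  here : ∀ {u} → P u → WalkIn G P u u
  step : ∀ {u w v} → P u → Adj G u w → WalkIn G P w v → WalkIn G P u v

record _≼_ (H G : Graph) : Set₁ where
  field
    branch    : V H → V G → Set
    disjoint  : ∀ h h' → h ≢ h' → ∀ v → branch h v → ¬ branch h' v
    nonempty  : ∀ h → ∃ λ v → branch h v
    connected : ∀ h u v → branch h u → branch h v → WalkIn G (branch h) u v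
    edges     : ∀ h h' → Adj H h h' →
                ∃ λ u → ∃ λ v → branch h u × branch h' v × Adj G u v

MinorEquivalent : Graph → Graph → Set₁
MinorEquivalent H G = (H ≼ G) × (G ≼ H)

-- Vertices: the two ends `lft`, `rgt` of F̌₀, and a vertex `mid w` for
-- every blue edge w ever created.  Blue edges of F̌ₙ are indexed by
-- lists w of length n (head = most recent choice): the blue edge []
-- is the edge of F̌₀, and the blue edge w (of F̌ₙ) spawns mid w and the
-- two blue edges (false ∷ w), (true ∷ w) of F̌ₙ₊₁.

data FV : Set where
  lft rgt : FV
  mid     : List Bool → FV

ends : List Bool → FV × FV
ends []          = lft , rgt
ends (false ∷ w) = proj₁ (ends w) , mid w
ends (true  ∷ w) = mid w , proj₂ (ends w)

data FEdge : FV → FV → Set where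
  base  : FEdge lft rgt
  left  : ∀ w → FEdge (mid w) (proj₁ (ends w))
  right : ∀ w → FEdge (mid w) (proj₂ (ends w))

halvedFarey : Graph
halvedFarey = record
  { V   = FV
  ; Adj = λ u v → FEdge u v ⊎ FEdge v u }

-- Farey graph: union of two copies of F̌ meeting exactly in F̌₀.

data FarV : Set where
  lft rgt : FarV
  mid     : Bool → List Bool → FarV

emb : Bool → FV → FarV
emb c lft     = lft
emb c rgt     = rgt
emb c (mid w) = mid c w

farey : Graph
farey = record
  { V   = FarV
  ; Adj = λ x y → ∃ λ c → ∃ λ u → ∃ λ v →
            Adj halvedFarey u v × emb c u ≡ x × emb c v ≡ y }

{-# OPTIONS --safe #-}
-- F̌ is a subgraph of F, being one of its two halves.
-- Conversely, contracting the base edge lft–rgt of F̌ yields F: the two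
-- halves of F̌ above the blue edges [false] (ends lft, mid []) and [true]
-- (ends mid [], rgt) are copies of F̌ which, after the contraction, meet
-- exactly in the edge {lft, rgt} – mid [] playing the role of F̌₀.
module Submission where

open import Defs
open import Data.Bool using (Bool; true; false; not)
open import Data.List using (List; []; _∷_; _++_; [_]; map)
open import Data.Product using (∃; _×_; _,_; proj₁; proj₂)
open import Data.Sum using (_⊎_; inj₁; inj₂)
open import Function using (_∘_)
open import Function.Definitions using (Injective)
open import Function.Consequences.Propositional
  using (inverseʳ⇒injective; strictlyInverseʳ⇒inverseʳ)
open import Relation.Binary.PropositionalEquality using (_≡_; _≢_; refl; sym; trans; cong; subst)
open import Relation.Nullary using (¬_)

IsHom : (G H : Graph) → (V G → V H) → Set
IsHom G H f = ∀ {u v} → Adj G u v → Adj H (f u) (f v)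

≼-fromEmbedding : ∀ {H G} (f : V H → V G) →
                  Injective _≡_ _≡_ f → IsHom H G f → H ≼ G
≼-fromEmbedding f f-inj f-hom = record
  { branch    = λ h v → f h ≡ v
  ; disjoint  = λ h h' h≢h' v fh≡v fh'≡v → h≢h' (f-inj (trans fh≡v (sym fh'≡v)))
  ; nonempty  = λ h → f h , refl
  ; connected = λ { h u .u refl refl → here refl }
  ; edges     = λ h h' hh' → f h , f h' , refl , refl , f-hom hh'
  }

fibres-disjoint : ∀ {A B : Set} (ψ : A → B) (branch : B → A → Set) →
                  (∀ b a → branch b a → ψ a ≡ b) →
                  ∀ b b' → b ≢ b' → ∀ a → branch b a → ¬ branch b' a
fibres-disjoint ψ branch in-fibre b b' b≢b' a a∈b a∈b' =
  b≢b' (trans (sym (in-fibre b a a∈b)) (in-fibre b' a a∈b'))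

A : FV → FV → Set
A = Adj halvedFarey

A-sym : ∀ {u v} → A u v → A v u
A-sym (inj₁ e) = inj₂ e
A-sym (inj₂ e) = inj₁ e

isHom-fromFEdge : (f : FV → FV) → (∀ {u v} → FEdge u v → A (f u) (f v)) →
                  IsHom halvedFarey halvedFarey f
isHom-fromFEdge f f-hom (inj₁ e) = f-hom e
isHom-fromFEdge f f-hom (inj₂ e) = A-sym (f-hom e)

ends-adjacent : ∀ w → A (proj₁ (ends w)) (proj₂ (ends w))
ends-adjacent []          = inj₁ base
ends-adjacent (false ∷ w) = inj₂ (left w)
ends-adjacent (true ∷ w)  = inj₁ (right w)

reflect : FV → FV
reflect lft     = rgt
reflect rgt     = lft
reflect (mid w) = mid (map not w)

ends-reflect : ∀ w → ends (map not w) ≡ (reflect (proj₂ (ends w)) , reflect (proj₁ (ends w)))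
ends-reflect []          = refl
ends-reflect (false ∷ w) = cong (λ e → mid (map not w) , proj₂ e) (ends-reflect w)
ends-reflect (true ∷ w)  = cong (λ e → proj₁ e , mid (map not w)) (ends-reflect w)

reflect-isHom : IsHom halvedFarey halvedFarey reflect
reflect-isHom = isHom-fromFEdge reflect reflect-FEdge
  where
  reflect-FEdge : ∀ {u v} → FEdge u v → A (reflect u) (reflect v)
  reflect-FEdge base      = inj₂ base
  reflect-FEdge (left w)  =
    inj₁ (subst (FEdge (mid (map not w)) ∘ proj₂) (ends-reflect w) (right (map not w)))
  reflect-FEdge (right w) =
    inj₁ (subst (FEdge (mid (map not w)) ∘ proj₁) (ends-reflect w) (left (map not w)))

-- The copy of F̌ spanned by the blue edge u and everything created above it.

above : List Bool → FV → FV
above u lft     = proj₁ (ends u)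
above u rgt     = proj₂ (ends u)
above u (mid w) = mid (w ++ u)

ends-++ : ∀ w u → ends (w ++ u) ≡ (above u (proj₁ (ends w)) , above u (proj₂ (ends w)))
ends-++ []          u = refl
ends-++ (false ∷ w) u = cong (λ e → proj₁ e , mid (w ++ u)) (ends-++ w u)
ends-++ (true ∷ w)  u = cong (λ e → mid (w ++ u) , proj₂ e) (ends-++ w u)

above-isHom : ∀ u → IsHom halvedFarey halvedFarey (above u)
above-isHom u = isHom-fromFEdge (above u) above-FEdge
  where
  above-FEdge : ∀ {v v'} → FEdge v v' → A (above u v) (above u v')
  above-FEdge base      = ends-adjacent u
  above-FEdge (left w)  =
    inj₁ (subst (FEdge (mid (w ++ u)) ∘ proj₁) (ends-++ w u) (left (w ++ u)))
  above-FEdge (right w) =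
    inj₁ (subst (FEdge (mid (w ++ u)) ∘ proj₂) (ends-++ w u) (right (w ++ u)))

unemb : FarV → FV
unemb lft       = lft
unemb rgt       = rgt
unemb (mid _ w) = mid w

unemb-emb : ∀ c u → unemb (emb c u) ≡ u
unemb-emb c lft     = refl
unemb-emb c rgt     = refl
unemb-emb c (mid w) = refl

emb-injective : ∀ c → Injective _≡_ _≡_ (emb c)
emb-injective c = inverseʳ⇒injective (emb c) (strictlyInverseʳ⇒inverseʳ {f⁻¹ = unemb} (emb c) (unemb-emb c))

emb-isHom : ∀ c → IsHom halvedFarey farey (emb c)
emb-isHom c {u} {v} uv = c , u , v , uv , refl , refl

halvedFarey≼farey : halvedFarey ≼ farey
halvedFarey≼farey = ≼-fromEmbedding (emb false) (emb-injective false) (emb-isHom false)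

-- Copy c of F̌ inside F is realised above the blue edge [ c ]; copy true
-- is reflected so that its lft lands in the contracted base edge.
copy : Bool → FV → FV
copy false = above [ false ]
copy true  = above [ true ] ∘ reflect

copy-isHom : ∀ c → IsHom halvedFarey halvedFarey (copy c)
copy-isHom false = above-isHom [ false ]
copy-isHom true  = above-isHom [ true ] ∘ reflect-isHom

branch : FarV → FV → Set
branch lft       v = v ≡ lft ⊎ v ≡ rgt
branch rgt       v = v ≡ mid []
branch (mid c w) v = v ≡ copy c (mid w)

copy-∈-branch : ∀ c u → branch (emb c u) (copy c u)
copy-∈-branch false lft     = inj₁ refl
copy-∈-branch true  lft     = inj₂ refl
copy-∈-branch false rgt     = refl
copy-∈-branch true  rgt     = refl
copy-∈-branch c     (mid w) = refl

branch-nonempty : ∀ x → ∃ λ v → branch x v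
branch-nonempty lft       = lft , inj₁ refl
branch-nonempty rgt       = mid [] , refl
branch-nonempty (mid c w) = copy c (mid w) , refl

branch-connected : ∀ x u v → branch x u → branch x v → WalkIn halvedFarey (branch x) u v
branch-connected lft       _ _ (inj₁ refl) (inj₁ refl) = here (inj₁ refl)
branch-connected lft       _ _ (inj₂ refl) (inj₂ refl) = here (inj₂ refl)
branch-connected lft       _ _ (inj₁ refl) (inj₂ refl) = step (inj₁ refl) (inj₁ base) (here (inj₂ refl))
branch-connected lft       _ _ (inj₂ refl) (inj₁ refl) = step (inj₂ refl) (inj₂ base) (here (inj₁ refl))
branch-connected rgt       _ _ refl refl = here refl
branch-connected (mid c w) _ _ refl refl = here refl

branch-edges : ∀ x y → Adj farey x y → ∃ λ u → ∃ λ v → branch x u × branch y v × A u v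
branch-edges _ _ (c , u , v , uv , refl , refl) =
  copy c u , copy c v , copy-∈-branch c u , copy-∈-branch c v , copy-isHom c uv

-- Contracting the base edge: the oldest choice of w (its last letter)
-- selects the copy of F̌ that mid w belongs to.

extend : Bool → FarV → FarV
extend b lft           = lft
extend b rgt           = mid b []
extend b (mid false w) = mid false (b ∷ w)
extend b (mid true w)  = mid true (not b ∷ w)

address : List Bool → FarV
address []      = rgt
address (b ∷ w) = extend b (address w)

contract : FV → FarV
contract lft     = lft
contract rgt     = lft
contract (mid w) = address w

address-copy-false : ∀ w → address (w ++ [ false ]) ≡ mid false w
address-copy-false []      = refl
address-copy-false (b ∷ w) = cong (extend b) (address-copy-false w)

address-copy-true : ∀ w → address (map not w ++ [ true ]) ≡ mid true w
address-copy-true []          = refl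
address-copy-true (false ∷ w) = cong (extend true) (address-copy-true w)
address-copy-true (true ∷ w)  = cong (extend false) (address-copy-true w)

branch⊆fibre : ∀ x v → branch x v → contract v ≡ x
branch⊆fibre lft           _ (inj₁ refl) = refl
branch⊆fibre lft           _ (inj₂ refl) = refl
branch⊆fibre rgt           _ refl        = refl
branch⊆fibre (mid false w) _ refl        = address-copy-false w
branch⊆fibre (mid true w)  _ refl        = address-copy-true w

farey≼halvedFarey : farey ≼ halvedFarey
farey≼halvedFarey = record
  { branch    = branch
  ; disjoint  = fibres-disjoint contract branch branch⊆fibre
  ; nonempty  = branch-nonempty
  ; connected = branch-connected
  ; edges     = branch-edges
  }

lemma2p1 : MinorEquivalent halvedFarey farey
lemma2p1 = halvedFarey≼farey , farey≼halvedFarey
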